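{- Let $n$ be a positive integer, $0<p\le1/2$ with $pn$ an integer, let $P$ be a $k$-tuple, $T\subseteq[n]$, and $f\colon\binom{[n]}{pn}\to\mathbb{R}$. Then: (1) If $|T|<k$, then $D_P(\mathrm{AND}_T)\equiv 0$. (2) If $|T|=k$, then $D_P(\mathrm{AND}_T)\equiv0$ unless each pair of $P$ contains exactly one element of $T$, in which case $D_P(\mathrm{AND}_T)\in\{\Psi_P/2^k,-\Psi_P/2^k\}$. (3) $D_P(f)=D_P(f^{\ge k})$. (4) For every positive integer $m$, $D_P(f)^{>m}=D_P(f^{>m})^{>m}$.
   Context: The slice $\binom{[n]}{pn}=\{x\in\{0,1\}^n:\sum_ix_i=pn\}$ has the uniform probability measure and inner product $\langle f,g\rangle=\mathbb{E}_x[f(x)g(x)]$. $\mathrm{AND}_T(x)=\prod_{i\in T}x_i$. $L_d$ is the span of $\{\mathrm{AND}_S:|S|\le d\}$ as functions on the slice ($L_{ -1}=\{0\}$); $f^{=d}$ is the orthogonal projection of $f$ onto $L_d\cap L_{d-1}^\perp$, $f^{\ge k}=\sum_{d\ge k}f^{=d}$ and $f^{>m}=\sum_{d>m}f^{=d}$. For a permutation $\pi$, $(x^\pi)_i=x_{\pi^{ -1}(i)}$ and $f^\pi(x)=f(x^\pi)$; for $i\neq j$, $D_{ij}f=\frac12(f-f^{(ij)})$ with $(ij)$ the transposition. A $k$-tuple is a set $P=\{(a_1,b_1),\dots,(a_k,b_k)\}$ of ordered pairs in $[n]$ with $a_t<b_t$ and all $2k$ elements distinct; $D_P=D_{a_kb_k}\circ\cdots\circ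 D_{a_1b_1}$, and $\Psi_P(x)=\prod_{(a,b)\in P}(x_b-x_a)$.
   Formalization: The function f takes values in ℚ instead of ℝ, so the spans $L_d$ and the projections $f^{=d}$ are taken over ℚ as well. -}

module Defs where

open import Data.Bool using (Bool; true; false; if_then_else_; _xor_)
open import Data.Nat as ℕ using (ℕ; zero; suc)
open import Data.Fin using (Fin)
open import Data.Fin.Subset using (Subset; ∣_∣)
open import Data.Fin.Permutation.Components using (transpose)
open import Data.Vec using (Vec; []; _∷_; lookup; tabulate; zipWith; foldr)
open import Data.List as List using (List; []; _∷_; concatMap; filter)
open import Data.List.Relation.Unary.All using (All)
open import Data.List.Relation.Unary.Unique.Propositional using (Unique)
open import Data.Product using (Σ; _×_; _,_)
open import Data.Rational using (ℚ; 0ℚ; 1ℚ; ½; _+_; _*_; _-_)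
open import Relation.Binary.PropositionalEquality using (_≡_)
open import Relation.Nullary using (¬_)

-- The slice ([n] choose m) with m = pn
-- is the set of x with countT x ≡ m.  Functions on the slice are
-- represented by functions Vec Bool n → ℚ; only their values on the slice
-- ever matter (all notions below only inspect slice values).

countT : ∀ {n} → Vec Bool n → ℕ
countT []          = 0
countT (true ∷ x)  = suc (countT x)
countT (false ∷ x) = countT x

allVecs : (n : ℕ) → List (Vec Bool n)
allVecs zero    = [] ∷ []
allVecs (suc n) = List.map (true ∷_) (allVecs n) List.++ List.map (false ∷_) (allVecs n)

slice : (n m : ℕ) → List (Vec Bool n)
slice n m = filter (λ x → countT x ℕ.≟ m) (allVecs n)

Fun : ℕ → Set
Fun n = Vec Bool n → ℚ

_≈[_]_ : ∀ {n} → Fun n → ℕ → Fun n → Set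
f ≈[ m ] g = ∀ x → countT x ≡ m → f x ≡ g x

b2q : Bool → ℚ
b2q true  = 1ℚ
b2q false = 0ℚ

sumℚ : List ℚ → ℚ
sumℚ = List.foldr _+_ 0ℚ

-- ⟨f,g⟩ up to the positive factor 1/|slice| (only used via orthogonality)
inner : ∀ {n} → ℕ → Fun n → Fun n → ℚ
inner {n} m f g = sumℚ (List.map (λ x → f x * g x) (slice n m))

_⊥[_]_ : ∀ {n} → Fun n → ℕ → Fun n → Set
f ⊥[ m ] g = inner m f g ≡ 0ℚ

AND : ∀ {n} → Subset n → Fun n
AND T x = foldr (λ _ → ℚ) _*_ 1ℚ (zipWith (λ t xi → if t then b2q xi else 1ℚ) T x)

-- f ∈ L_{<d} : f agrees on the slice with a linear combination of AND_S, |S| < d.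
-- Thus L_d = InL< (suc d), and L_{-1} = InL< 0 = {0}.
InL< : ∀ {n} → ℕ → ℕ → Fun n → Set
InL< {n} m d f =
  Σ (List (Subset n × ℚ)) λ cs →
    All (λ sc → ∣ Data.Product.proj₁ sc ∣ ℕ.< d) cs ×
    (f ≈[ m ] (λ x → sumℚ (List.map (λ sc → Data.Product.proj₂ sc * AND (Data.Product.proj₁ sc) x) cs)))

-- g = f^{=d} : the orthogonal projection of f onto L_d ∩ L_{d-1}^⊥
IsLevel : ∀ {n} → ℕ → ℕ → Fun n → Fun n → Set
IsLevel m d f g =
  InL< m (suc d) g ×
  (∀ h → InL< m d h → g ⊥[ m ] h) ×
  (∀ h → InL< m (suc d) h → (∀ h' → InL< m d h' → h ⊥[ m ] h') →
        (λ x → f x - g x) ⊥[ m ] h)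

IsDecomp : ∀ {n} → ℕ → Fun n → (ℕ → Fun n) → Set
IsDecomp m f hs = ∀ d → IsLevel m d f (hs d)

sumTo : ℕ → (ℕ → ℚ) → ℚ
sumTo zero    g = 0ℚ
sumTo (suc N) g = sumTo N g + g N

-- f^{≥k} = Σ_{d ≥ k} f^{=d}; f^{=d} = 0 for d > n, so the sum stops at n.
geq : ∀ {n} → ℕ → (ℕ → Fun n) → Fun n
geq {n} k hs x = sumTo (suc n) (λ d → if ℕ._≤ᵇ_ k d then hs d x else 0ℚ)

gt : ∀ {n} → ℕ → (ℕ → Fun n) → Fun n
gt r hs = geq (suc r) hs

swapV : ∀ {n} → Fin n → Fin n → Vec Bool n → Vec Bool n
swapV i j x = tabulate (λ t → lookup x (transpose i j t))

D : ∀ {n} → Fin n → Fin n → Fun n → Fun n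
D i j f x = ½ * (f x - f (swapV i j x))

-- tuples: lists of pairs (a,b); k = length
pairElems : ∀ {n} → List (Fin n × Fin n) → List (Fin n)
pairElems = concatMap (λ ab → Data.Product.proj₁ ab ∷ Data.Product.proj₂ ab ∷ [])

IsTuple : ∀ {n} → List (Fin n × Fin n) → Set
IsTuple P = All (λ ab → Data.Product.proj₁ ab Data.Fin.< Data.Product.proj₂ ab) P × Unique (pairElems P)

-- D_P = D_{a_k b_k} ∘ ⋯ ∘ D_{a_1 b_1}  (first pair applied first)
DP : ∀ {n} → List (Fin n × Fin n) → Fun n → Fun n
DP []             f = f
DP ((a , b) ∷ P) f = DP P (D a b f)

Ψ : ∀ {n} → List (Fin n × Fin n) → Fun n
Ψ P x = List.foldr (λ ab r → (b2q (lookup x (Data.Product.proj₂ ab)) - b2q (lookup x (Data.Product.proj₁ ab))) * r) 1ℚ P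

half^ : ℕ → ℚ
half^ zero    = 1ℚ
half^ (suc k) = ½ * half^ k

EachPairOne : ∀ {n} → Subset n → List (Fin n × Fin n) → Set
EachPairOne T P = All (λ ab → (lookup T (Data.Product.proj₁ ab) xor lookup T (Data.Product.proj₂ ab)) ≡ true) P

zeroF : ∀ {n} → Fun n
zeroF _ = 0ℚ

{-# OPTIONS --safe #-}

-- D_ab annihilates every function invariant under swapping a and b, and commutes with swaps of
-- coordinates outside {a, b}. So D_P AND_T = 0 as soon as some pair of P lies inside or outside T;
-- otherwise every pair contains exactly one element of T, which forces |T| ≥ k. In that case
-- D_ab (x_a AND_{T-a}) = ½ (x_a - x_b) AND_{T-a}, the factor ½ (x_a - x_b) passes through the remaining
-- operators, and induction gives ±2^{-k} Ψ_P AND_{T∖P}, whose last factor is 1 when |T| = k.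
-- For (3) and (4), f is the sum of its levels (orthogonal projections onto the spans L_d exist over ℚ
-- by Gram–Schmidt); f - f^{≥k} is a combination of AND_S with |S| < k, which D_P kills by (1); and D_P
-- maps each L_d into itself, so D_P f and D_P f^{>m} differ by an element of L_m and share their
-- components above level m.

module Submission where

open import Defs

module Lemmas where

  open import Data.Bool as Bool using (Bool; true; false; if_then_else_; _xor_; _∧_; _∨_; not)
  open import Data.Bool.Properties using (⇔→≡)
  open import Data.Empty using (⊥-elim)
  open import Data.Fin using (Fin; zero; suc; _≟_)
  open import Data.Fin.Subset using (Subset; ∣_∣)
  open import Data.Fin.Subset.Properties using (∣p∣≤n)
  open import Data.Fin.Permutation.Components using (transpose)
  open import Data.Vec using (Vec; []; _∷_; lookup; _[_]≔_)
  import Data.Vec.Properties as Vec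
  open import Data.List using (List; []; _∷_; _++_; map; filter; length)
  import Data.List.Properties as Listₚ
  open import Data.List.Membership.Propositional using (_∈_; find)
  open import Data.List.Relation.Unary.All as All using (All; []; _∷_)
  open import Data.List.Membership.Propositional.Properties using (∈-map⁺; ∈-++⁺ˡ; ∈-++⁺ʳ; ∈-filter⁺; ∈-filter⁻)
  open import Data.List.Relation.Unary.All.Properties using (¬All⇒Any¬; map⁺; ++⁺; all-filter)
  open import Data.List.Relation.Unary.Any using (here; there)
  open import Data.List.Relation.Unary.Unique.Propositional using (Unique)
  open import Data.List.Relation.Unary.AllPairs using (_∷_)
  open import Data.Nat as ℕ using (ℕ; zero; suc; s≤s)
  import Data.Nat.Properties as ℕ
  open import Data.Product using (Σ; ∃; ∃₂; _×_; _,_; proj₁; proj₂)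
  open import Data.Sign as Sign using (Sign)
  open import Data.Rational using (ℚ; 0ℚ; 1ℚ; ½; _+_; _*_; _-_; -_; 1/_; _≤_; _<_; NonZero; ≢-nonZero; positive; negative)
  import Data.Rational.Properties as ℚ
  open import Data.Rational.Solver using (module +-*-Solver)
  open import Data.Sum using (_⊎_; inj₁; inj₂)
  open import Relation.Binary.Definitions using (tri<; tri≈; tri>)
  open import Relation.Binary.PropositionalEquality
  open import Function using (_∘_)
  open import Function.Bundles using (mk⇔)
  open import Relation.Nullary using (Dec; yes; no; does; ¬_)
  open import Relation.Unary using (Pred; Decidable)

  open +-*-Solver

  private
    variable
      n : ℕ

  x*x-positive : ∀ x → x ≢ 0ℚ → 0ℚ < x * x
  x*x-positive x x≢0 with ℚ.<-cmp x 0ℚ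
  ... | tri< x<0 _ _ = let instance _ = negative x<0 in ℚ.positive⁻¹ (x * x) {{ℚ.neg*neg⇒pos x x}}
  ... | tri≈ _ x≡0 _ = ⊥-elim (x≢0 x≡0)
  ... | tri> _ _ x>0 = let instance _ = positive x>0 in ℚ.positive⁻¹ (x * x) {{ℚ.pos*pos⇒pos x x}}

  x*x-nonNeg : ∀ x → 0ℚ ≤ x * x
  x*x-nonNeg x with x ℚ.≟ 0ℚ
  ... | yes refl = ℚ.≤-refl
  ... | no x≢0 = ℚ.<⇒≤ (x*x-positive x x≢0)

  quotient : ∀ a N → (N ≡ 0ℚ → a ≡ 0ℚ) → ∃ λ c → a ≡ c * N
  quotient a N N≡0⇒a≡0 with N ℚ.≟ 0ℚ
  ... | yes N≡0 = 0ℚ , trans (N≡0⇒a≡0 N≡0) (sym (ℚ.*-zeroˡ N))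
  ... | no N≢0  = a * 1/ N , (begin
    a                ≡⟨ ℚ.*-identityʳ a ⟨
    a * 1ℚ           ≡⟨ cong (a *_) (ℚ.*-inverseˡ N) ⟨
    a * (1/ N * N)   ≡⟨ ℚ.*-assoc a (1/ N) N ⟨
    a * 1/ N * N     ∎)
    where
    open ≡-Reasoning
    instance
      N-nonZero : NonZero N
      N-nonZero = ≢-nonZero N≢0

  p-q≡0⇒p≡q : ∀ p q → p - q ≡ 0ℚ → p ≡ q
  p-q≡0⇒p≡q p q p-q≡0 = begin
    p             ≡⟨ solve 2 (λ p q → p := (p :- q) :+ q) refl p q ⟩
    p - q + q     ≡⟨ cong (_+ q) p-q≡0 ⟩
    0ℚ + q        ≡⟨ ℚ.+-identityˡ q ⟩
    q             ∎
    where open ≡-Reasoning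

  sumℚ-++ : ∀ xs ys → sumℚ (xs ++ ys) ≡ sumℚ xs + sumℚ ys
  sumℚ-++ []       ys = sym (ℚ.+-identityˡ _)
  sumℚ-++ (x ∷ xs) ys = trans (cong (x +_) (sumℚ-++ xs ys)) (sym (ℚ.+-assoc x _ _))

  module _ {A : Set} where

    sumℚ-map-+ : ∀ (f g : A → ℚ) xs → sumℚ (map (λ x → f x + g x) xs) ≡ sumℚ (map f xs) + sumℚ (map g xs)
    sumℚ-map-+ f g []       = refl
    sumℚ-map-+ f g (x ∷ xs) = trans (cong (f x + g x +_) (sumℚ-map-+ f g xs))
      (solve 4 (λ a b c d → (a :+ b) :+ (c :+ d) := (a :+ c) :+ (b :+ d)) refl (f x) (g x) _ _)

    sumℚ-map-* : ∀ c (f : A → ℚ) xs → sumℚ (map (λ x → c * f x) xs) ≡ c * sumℚ (map f xs)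
    sumℚ-map-* c f []       = sym (ℚ.*-zeroʳ c)
    sumℚ-map-* c f (x ∷ xs) = trans (cong (c * f x +_) (sumℚ-map-* c f xs)) (sym (ℚ.*-distribˡ-+ c (f x) _))

    sumℚ-map-cong : ∀ {f g : A → ℚ} xs → (∀ {x} → x ∈ xs → f x ≡ g x) → sumℚ (map f xs) ≡ sumℚ (map g xs)
    sumℚ-map-cong []       f≡g = refl
    sumℚ-map-cong (x ∷ xs) f≡g = cong₂ _+_ (f≡g (here refl)) (sumℚ-map-cong xs (f≡g ∘ there))

    sumℚ-map-zero : ∀ {f : A → ℚ} xs → (∀ {x} → x ∈ xs → f x ≡ 0ℚ) → sumℚ (map f xs) ≡ 0ℚ
    sumℚ-map-zero []       f≡0 = refl
    sumℚ-map-zero (x ∷ xs) f≡0 = trans (cong₂ _+_ (f≡0 (here refl)) (sumℚ-map-zero xs (f≡0 ∘ there))) (ℚ.+-identityˡ 0ℚ)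

    sumℚ-map-filter : ∀ {p} {P : Pred A p} (P? : Decidable P) (f : A → ℚ) xs →
      sumℚ (map f (filter P? xs)) ≡ sumℚ (map (λ x → if does (P? x) then f x else 0ℚ) xs)
    sumℚ-map-filter P? f [] = refl
    sumℚ-map-filter P? f (x ∷ xs) with does (P? x)
    ... | true  = cong (f x +_) (sumℚ-map-filter P? f xs)
    ... | false = trans (sumℚ-map-filter P? f xs) (sym (ℚ.+-identityˡ _))

    sumℚ-squares-nonNeg : ∀ (f : A → ℚ) xs → 0ℚ ≤ sumℚ (map (λ x → f x * f x) xs)
    sumℚ-squares-nonNeg f []       = ℚ.≤-refl
    sumℚ-squares-nonNeg f (x ∷ xs) = ℚ.+-mono-≤ (x*x-nonNeg (f x)) (sumℚ-squares-nonNeg f xs)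

    sumℚ-squares≡0 : ∀ (f : A → ℚ) xs → sumℚ (map (λ x → f x * f x) xs) ≡ 0ℚ → ∀ {x} → x ∈ xs → f x ≡ 0ℚ
    sumℚ-squares≡0 f (y ∷ xs) sum≡0 (here refl) with f y ℚ.≟ 0ℚ
    ... | yes fy≡0 = fy≡0
    ... | no fy≢0  = ⊥-elim (ℚ.<-irrefl (sym sum≡0)
                       (ℚ.+-mono-<-≤ (x*x-positive (f y) fy≢0) (sumℚ-squares-nonNeg f xs)))
    sumℚ-squares≡0 f (y ∷ xs) sum≡0 (there x∈xs) = sumℚ-squares≡0 f xs rest≡0 x∈xs
      where
      rest : ℚ
      rest = sumℚ (map (λ x → f x * f x) xs)
      rest≡0 : rest ≡ 0ℚ
      rest≡0 = begin
        rest                  ≡⟨ sym (ℚ.+-identityˡ rest) ⟩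
        0ℚ * 0ℚ + rest        ≡⟨ cong (λ z → z * z + rest) (sym (sumℚ-squares≡0 f (y ∷ xs) sum≡0 (here refl))) ⟩
        f y * f y + rest      ≡⟨ sum≡0 ⟩
        0ℚ                    ∎
        where open ≡-Reasoning

  sumTo-+ : ∀ N (a b : ℕ → ℚ) → sumTo N (λ e → a e + b e) ≡ sumTo N a + sumTo N b
  sumTo-+ zero    a b = refl
  sumTo-+ (suc N) a b = trans (cong (_+ (a N + b N)) (sumTo-+ N a b))
    (solve 4 (λ p q r s → (p :+ q) :+ (r :+ s) := (p :+ r) :+ (q :+ s)) refl (sumTo N a) (sumTo N b) (a N) (b N))

  sumTo-cong : ∀ N {a b : ℕ → ℚ} → (∀ {e} → e ℕ.< N → a e ≡ b e) → sumTo N a ≡ sumTo N b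
  sumTo-cong zero    a≡b = refl
  sumTo-cong (suc N) a≡b = cong₂ _+_ (sumTo-cong N (a≡b ∘ ℕ.m<n⇒m<1+n)) (a≡b (ℕ.n<1+n N))

  sumTo-zero : ∀ N {a : ℕ → ℚ} → (∀ {e} → e ℕ.< N → a e ≡ 0ℚ) → sumTo N a ≡ 0ℚ
  sumTo-zero zero    a≡0 = refl
  sumTo-zero (suc N) a≡0 = trans (cong₂ _+_ (sumTo-zero N (a≡0 ∘ ℕ.m<n⇒m<1+n)) (a≡0 (ℕ.n<1+n N))) (ℚ.+-identityˡ 0ℚ)

  sumTo-single : ∀ N {a : ℕ → ℚ} {d} → d ℕ.< N → (∀ {e} → e ℕ.< N → e ≢ d → a e ≡ 0ℚ) → sumTo N a ≡ a d
  sumTo-single (suc N) {a} {d} d<1+N others≡0 with d ℕ.≟ N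
  ... | yes refl = trans (cong (_+ a d) (sumTo-zero N (λ e<d → others≡0 (ℕ.m<n⇒m<1+n e<d) (ℕ.<⇒≢ e<d))))
                         (ℚ.+-identityˡ (a d))
  ... | no d≢N   = trans (cong₂ _+_ (sumTo-single N (ℕ.≤∧≢⇒< (ℕ.≤-pred d<1+N) d≢N) (others≡0 ∘ ℕ.m<n⇒m<1+n))
                                    (others≡0 (ℕ.n<1+n N) (d≢N ∘ sym)))
                         (ℚ.+-identityʳ (a d))

  sumTo-partition : ∀ N (p : ℕ → Bool) (a : ℕ → ℚ) →
    sumTo N a ≡ sumTo N (λ e → if p e then a e else 0ℚ) + sumTo N (λ e → if p e then 0ℚ else a e)
  sumTo-partition N p a = trans (sumTo-cong N (λ {e} _ → split (p e) (a e))) (sumTo-+ N _ _)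
    where
    split : ∀ b x → x ≡ (if b then x else 0ℚ) + (if b then 0ℚ else x)
    split true  x = sym (ℚ.+-identityʳ x)
    split false x = sym (ℚ.+-identityˡ x)

  if-does : ∀ {A : Set} (a? : Dec A) {u v w : ℚ} → (A → u ≡ w) → (¬ A → v ≡ w) → (if does a? then u else v) ≡ w
  if-does (yes a) u≡w _ = u≡w a
  if-does (no ¬a) _ v≡w = v≡w ¬a

  allVecs-complete : ∀ (x : Vec Bool n) → x ∈ allVecs n
  allVecs-complete []                = here refl
  allVecs-complete {suc n} (true  ∷ x) = ∈-++⁺ˡ (∈-map⁺ (true ∷_) (allVecs-complete x))
  allVecs-complete {suc n} (false ∷ x) = ∈-++⁺ʳ (map (true ∷_) (allVecs n)) (∈-map⁺ (false ∷_) (allVecs-complete x))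

  sumℚ-allVecs-suc : ∀ n (g : Vec Bool (suc n) → ℚ) →
    sumℚ (map g (allVecs (suc n))) ≡ sumℚ (map (g ∘ (true ∷_)) (allVecs n)) + sumℚ (map (g ∘ (false ∷_)) (allVecs n))
  sumℚ-allVecs-suc n g = begin
    sumℚ (map g (map (true ∷_) (allVecs n) ++ map (false ∷_) (allVecs n)))
      ≡⟨ cong sumℚ (Listₚ.map-++ g (map (true ∷_) (allVecs n)) _) ⟩
    sumℚ (map g (map (true ∷_) (allVecs n)) ++ map g (map (false ∷_) (allVecs n)))
      ≡⟨ sumℚ-++ (map g (map (true ∷_) (allVecs n))) _ ⟩
    sumℚ (map g (map (true ∷_) (allVecs n))) + sumℚ (map g (map (false ∷_) (allVecs n)))
      ≡⟨ cong₂ _+_ (cong sumℚ (sym (Listₚ.map-∘ (allVecs n)))) (cong sumℚ (sym (Listₚ.map-∘ (allVecs n)))) ⟩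
    sumℚ (map (g ∘ (true ∷_)) (allVecs n)) + sumℚ (map (g ∘ (false ∷_)) (allVecs n)) ∎
    where open ≡-Reasoning

  sumℚ-allVecs-single : ∀ n (g : Vec Bool n → ℚ) y → (∀ x → x ≢ y → g x ≡ 0ℚ) → sumℚ (map g (allVecs n)) ≡ g y
  sumℚ-allVecs-single zero    g [] _ = ℚ.+-identityʳ (g [])
  sumℚ-allVecs-single (suc n) g (true ∷ y) g≡0 = trans (sumℚ-allVecs-suc n g) (trans
    (cong₂ _+_ (sumℚ-allVecs-single n (g ∘ (true ∷_)) y (λ x x≢y → g≡0 (true ∷ x) (x≢y ∘ Vec.∷-injectiveʳ)))
               (sumℚ-map-zero (allVecs n) (λ {x} _ → g≡0 (false ∷ x) (λ ()))))
    (ℚ.+-identityʳ _))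
  sumℚ-allVecs-single (suc n) g (false ∷ y) g≡0 = trans (sumℚ-allVecs-suc n g) (trans
    (cong₂ _+_ (sumℚ-map-zero (allVecs n) (λ {x} _ → g≡0 (true ∷ x) (λ ())))
               (sumℚ-allVecs-single n (g ∘ (false ∷_)) y (λ x x≢y → g≡0 (false ∷ x) (x≢y ∘ Vec.∷-injectiveʳ))))
    (ℚ.+-identityˡ _))

  -- Transpositions

  data Transposition (i j : Fin n) : Fin n → Fin n → Set where
    at-first  : Transposition i j i j
    at-second : j ≢ i → Transposition i j j i
    elsewhere : ∀ {k} → k ≢ i → k ≢ j → Transposition i j k k

  transposition : (i j k : Fin n) → Transposition i j k (transpose i j k)
  transposition i j k with k ≟ i
  ... | yes refl = at-first
  ... | no k≢i with k ≟ j
  ...   | yes refl = at-second k≢i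
  ...   | no k≢j   = elsewhere k≢i k≢j

  transpose-first : (i j : Fin n) → transpose i j i ≡ j
  transpose-first i j with transpose i j i | transposition i j i
  ... | _ | at-first       = refl
  ... | _ | at-second _    = refl
  ... | _ | elsewhere i≢i _ = ⊥-elim (i≢i refl)

  transpose-second : (i j : Fin n) → transpose i j j ≡ i
  transpose-second i j with transpose i j j | transposition i j j
  ... | _ | at-first         = refl
  ... | _ | at-second _      = refl
  ... | _ | elsewhere _ j≢j  = ⊥-elim (j≢j refl)

  transpose-elsewhere : ∀ {i j k : Fin n} → k ≢ i → k ≢ j → transpose i j k ≡ k
  transpose-elsewhere {i = i} {j} {k} k≢i k≢j with transpose i j k | transposition i j k
  ... | _ | at-first    = ⊥-elim (k≢i refl)
  ... | _ | at-second _ = ⊥-elim (k≢j refl)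
  ... | _ | elsewhere _ _ = refl

  transpose-involutive : (i j k : Fin n) → transpose i j (transpose i j k) ≡ k
  transpose-involutive i j k with transpose i j k | transposition i j k
  ... | _ | at-first          = transpose-second i j
  ... | _ | at-second _       = transpose-first i j
  ... | _ | elsewhere k≢i k≢j = transpose-elsewhere k≢i k≢j

  transpose-comm : ∀ {a b c d : Fin n} → a ≢ c → a ≢ d → b ≢ c → b ≢ d → ∀ k →
    transpose a b (transpose c d k) ≡ transpose c d (transpose a b k)
  transpose-comm {a = a} {b} {c} {d} a≢c a≢d b≢c b≢d k with transpose a b k | transposition a b k
  ... | _ | at-first = begin
    transpose a b (transpose c d a) ≡⟨ cong (transpose a b) (transpose-elsewhere a≢c a≢d) ⟩
    transpose a b a                 ≡⟨ transpose-first a b ⟩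
    b                               ≡⟨ transpose-elsewhere b≢c b≢d ⟨
    transpose c d b                 ∎
    where open ≡-Reasoning
  ... | _ | at-second _ = begin
    transpose a b (transpose c d b) ≡⟨ cong (transpose a b) (transpose-elsewhere b≢c b≢d) ⟩
    transpose a b b                 ≡⟨ transpose-second a b ⟩
    a                               ≡⟨ transpose-elsewhere a≢c a≢d ⟨
    transpose c d a                 ∎
    where open ≡-Reasoning
  ... | _ | elsewhere k≢a k≢b with transpose c d k | transposition c d k
  ...   | _ | at-first       = transpose-elsewhere (a≢d ∘ sym) (b≢d ∘ sym)
  ...   | _ | at-second _    = transpose-elsewhere (a≢c ∘ sym) (b≢c ∘ sym)
  ...   | _ | elsewhere _ _  = transpose-elsewhere k≢a k≢b

  lookup-ext : ∀ {A : Set} {xs ys : Vec A n} → (∀ k → lookup xs k ≡ lookup ys k) → xs ≡ ys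
  lookup-ext {xs = xs} {ys} eq = trans (sym (Vec.tabulate∘lookup xs)) (trans (Vec.tabulate-cong eq) (Vec.tabulate∘lookup ys))

  module _ (i j : Fin n) where

    lookup-swapV : ∀ (x : Vec Bool n) k → lookup (swapV i j x) k ≡ lookup x (transpose i j k)
    lookup-swapV x = Vec.lookup∘tabulate _

    lookup-swapV-first : ∀ x → lookup (swapV i j x) i ≡ lookup x j
    lookup-swapV-first x = trans (lookup-swapV x i) (cong (lookup x) (transpose-first i j))

    lookup-swapV-second : ∀ x → lookup (swapV i j x) j ≡ lookup x i
    lookup-swapV-second x = trans (lookup-swapV x j) (cong (lookup x) (transpose-second i j))

    lookup-swapV-elsewhere : ∀ x {k} → k ≢ i → k ≢ j → lookup (swapV i j x) k ≡ lookup x k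
    lookup-swapV-elsewhere x k≢i k≢j = trans (lookup-swapV x _) (cong (lookup x) (transpose-elsewhere k≢i k≢j))

    swapV-fixes : ∀ x → lookup x i ≡ lookup x j → swapV i j x ≡ x
    swapV-fixes x xi≡xj = lookup-ext λ k → trans (lookup-swapV x k) (fixes k)
      where
      fixes : ∀ k → lookup x (transpose i j k) ≡ lookup x k
      fixes k with transpose i j k | transposition i j k
      ... | _ | at-first      = sym xi≡xj
      ... | _ | at-second _   = xi≡xj
      ... | _ | elsewhere _ _ = refl

    swapV-by-updates : ∀ x → swapV i j x ≡ (x [ i ]≔ lookup x j) [ j ]≔ lookup x i
    swapV-by-updates x = lookup-ext λ k → trans (lookup-swapV x k) (agree k)
      where
      y = x [ i ]≔ lookup x j
      agree : ∀ k → lookup x (transpose i j k) ≡ lookup (y [ j ]≔ lookup x i) k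
      agree k with transpose i j k | transposition i j k
      ... | _ | at-second _ = sym (Vec.lookup∘update j y (lookup x i))
      ... | _ | elsewhere k≢i k≢j =
        sym (trans (Vec.lookup∘update′ k≢j y _) (Vec.lookup∘update′ k≢i x _))
      ... | _ | at-first with i ≟ j
      ...   | yes refl = sym (Vec.lookup∘update i y (lookup x i))
      ...   | no i≢j   = sym (trans (Vec.lookup∘update′ i≢j y _) (Vec.lookup∘update i x _))

  swapV-comm : ∀ {a b c d : Fin n} → a ≢ c → a ≢ d → b ≢ c → b ≢ d → ∀ x →
    swapV c d (swapV a b x) ≡ swapV a b (swapV c d x)
  swapV-comm {a = a} {b} {c} {d} a≢c a≢d b≢c b≢d x = lookup-ext λ k → begin
    lookup (swapV c d (swapV a b x)) k   ≡⟨ lookup-swapV c d (swapV a b x) k ⟩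
    lookup (swapV a b x) (transpose c d k) ≡⟨ lookup-swapV a b x _ ⟩
    lookup x (transpose a b (transpose c d k)) ≡⟨ cong (lookup x) (transpose-comm a≢c a≢d b≢c b≢d k) ⟩
    lookup x (transpose c d (transpose a b k)) ≡⟨ lookup-swapV c d x _ ⟨
    lookup (swapV c d x) (transpose a b k) ≡⟨ lookup-swapV a b (swapV c d x) k ⟨
    lookup (swapV a b (swapV c d x)) k   ∎
    where open ≡-Reasoning

  b2n : Bool → ℕ
  b2n true  = 1
  b2n false = 0

  countT-update : ∀ (x : Vec Bool n) i v → countT (x [ i ]≔ v) ℕ.+ b2n (lookup x i) ≡ countT x ℕ.+ b2n v
  countT-update (true  ∷ x) zero    true  = refl
  countT-update (true  ∷ x) zero    false = trans (ℕ.+-comm (countT x) 1) (sym (ℕ.+-identityʳ _))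
  countT-update (false ∷ x) zero    true  = trans (ℕ.+-identityʳ _) (ℕ.+-comm 1 (countT x))
  countT-update (false ∷ x) zero    false = refl
  countT-update (true  ∷ x) (suc i) v     = cong suc (countT-update x i v)
  countT-update (false ∷ x) (suc i) v     = countT-update x i v

  countT-swapV : ∀ (i j : Fin n) x → countT (swapV i j x) ≡ countT x
  countT-swapV i j x = ℕ.+-cancelʳ-≡ _ _ _ (begin
    countT (swapV i j x) ℕ.+ b2n (lookup x j)   ≡⟨ cong (λ z → countT z ℕ.+ b2n (lookup x j)) (swapV-by-updates i j x) ⟩
    countT (y [ j ]≔ lookup x i) ℕ.+ b2n (lookup x j) ≡⟨ cong (λ b → countT (y [ j ]≔ lookup x i) ℕ.+ b2n b) yj≡xj ⟨
    countT (y [ j ]≔ lookup x i) ℕ.+ b2n (lookup y j) ≡⟨ countT-update y j (lookup x i) ⟩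
    countT y ℕ.+ b2n (lookup x i)               ≡⟨ countT-update x i (lookup x j) ⟩
    countT x ℕ.+ b2n (lookup x j)               ∎)
    where
    open ≡-Reasoning
    y = x [ i ]≔ lookup x j
    yj≡xj : lookup y j ≡ lookup x j
    yj≡xj with j ≟ i
    ... | yes refl = Vec.lookup∘update j x (lookup x j)
    ... | no j≢i   = Vec.lookup∘update′ j≢i x (lookup x j)

  ∣∣≡countT : (S : Subset n) → ∣ S ∣ ≡ countT S
  ∣∣≡countT []          = refl
  ∣∣≡countT (true  ∷ S) = cong suc (∣∣≡countT S)
  ∣∣≡countT (false ∷ S) = ∣∣≡countT S

  ∣swapV∣ : ∀ (i j : Fin n) S → ∣ swapV i j S ∣ ≡ ∣ S ∣
  ∣swapV∣ i j S = trans (∣∣≡countT (swapV i j S)) (trans (countT-swapV i j S) (sym (∣∣≡countT S)))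

  ∣∣-remove : ∀ (S : Subset n) i → lookup S i ≡ true → ∣ S ∣ ≡ suc ∣ S [ i ]≔ false ∣
  ∣∣-remove (true  ∷ S) zero    _    = refl
  ∣∣-remove (true  ∷ S) (suc i) Si≡1 = cong suc (∣∣-remove S i Si≡1)
  ∣∣-remove (false ∷ S) (suc i) Si≡1 = ∣∣-remove S i Si≡1

  -- Monomials

  _⊆_ : Vec Bool n → Vec Bool n → Set
  S ⊆ x = ∀ t → lookup S t ≡ true → lookup x t ≡ true

  _⊆ᵇ_ : Vec Bool n → Vec Bool n → Bool
  []      ⊆ᵇ []      = true
  (s ∷ S) ⊆ᵇ (y ∷ x) = (not s ∨ y) ∧ (S ⊆ᵇ x)

  ⊆ᵇ-sound : ∀ (S x : Vec Bool n) → S ⊆ᵇ x ≡ true → S ⊆ x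
  ⊆ᵇ-sound (true  ∷ S) (true ∷ x) _   zero    _  = refl
  ⊆ᵇ-sound (true  ∷ S) (true ∷ x) S⊆x (suc t) St = ⊆ᵇ-sound S x S⊆x t St
  ⊆ᵇ-sound (false ∷ S) (true  ∷ x) S⊆x (suc t) St = ⊆ᵇ-sound S x S⊆x t St
  ⊆ᵇ-sound (false ∷ S) (false ∷ x) S⊆x (suc t) St = ⊆ᵇ-sound S x S⊆x t St

  ⊆ᵇ-complete : ∀ (S x : Vec Bool n) → S ⊆ x → S ⊆ᵇ x ≡ true
  ⊆ᵇ-complete []          []          _   = refl
  ⊆ᵇ-complete (true  ∷ S) (false ∷ x) S⊆x = S⊆x zero refl
  ⊆ᵇ-complete (true  ∷ S) (true  ∷ x) S⊆x = ⊆ᵇ-complete S x (S⊆x ∘ suc)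
  ⊆ᵇ-complete (false ∷ S) (true  ∷ x) S⊆x = ⊆ᵇ-complete S x (S⊆x ∘ suc)
  ⊆ᵇ-complete (false ∷ S) (false ∷ x) S⊆x = ⊆ᵇ-complete S x (S⊆x ∘ suc)

  AND-⊆ᵇ : ∀ (S x : Vec Bool n) → AND S x ≡ b2q (S ⊆ᵇ x)
  AND-⊆ᵇ []          []          = refl
  AND-⊆ᵇ (true  ∷ S) (true  ∷ x) = trans (ℚ.*-identityˡ _) (AND-⊆ᵇ S x)
  AND-⊆ᵇ (true  ∷ S) (false ∷ x) = ℚ.*-zeroˡ (AND S x)
  AND-⊆ᵇ (false ∷ S) (y     ∷ x) = trans (ℚ.*-identityˡ _) (AND-⊆ᵇ S x)

  module _ (a b : Fin n) (S x : Vec Bool n) where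

    ⊆-swapV⁺ : S ⊆ swapV a b x → swapV a b S ⊆ x
    ⊆-swapV⁺ S⊆x t St = begin
      lookup x t                                   ≡⟨ cong (lookup x) (transpose-involutive a b t) ⟨
      lookup x (transpose a b (transpose a b t))   ≡⟨ lookup-swapV a b x _ ⟨
      lookup (swapV a b x) (transpose a b t)       ≡⟨ S⊆x _ (trans (sym (lookup-swapV a b S t)) St) ⟩
      true                                         ∎
      where open ≡-Reasoning

    ⊆-swapV⁻ : swapV a b S ⊆ x → S ⊆ swapV a b x
    ⊆-swapV⁻ S⊆x t St = trans (lookup-swapV a b x t) (S⊆x _ (begin
      lookup (swapV a b S) (transpose a b t)       ≡⟨ lookup-swapV a b S _ ⟩
      lookup S (transpose a b (transpose a b t))   ≡⟨ cong (lookup S) (transpose-involutive a b t) ⟩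
      lookup S t                                   ≡⟨ St ⟩
      true                                         ∎))
      where open ≡-Reasoning

    AND-swapV : AND S (swapV a b x) ≡ AND (swapV a b S) x
    AND-swapV = begin
      AND S (swapV a b x)        ≡⟨ AND-⊆ᵇ S (swapV a b x) ⟩
      b2q (S ⊆ᵇ swapV a b x)     ≡⟨ cong b2q (⇔→≡ (mk⇔ to from)) ⟩
      b2q (swapV a b S ⊆ᵇ x)     ≡⟨ AND-⊆ᵇ (swapV a b S) x ⟨
      AND (swapV a b S) x        ∎
      where
      open ≡-Reasoning
      to : S ⊆ᵇ swapV a b x ≡ true → swapV a b S ⊆ᵇ x ≡ true
      to = ⊆ᵇ-complete (swapV a b S) x ∘ ⊆-swapV⁺ ∘ ⊆ᵇ-sound S (swapV a b x)
      from : swapV a b S ⊆ᵇ x ≡ true → S ⊆ᵇ swapV a b x ≡ true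
      from = ⊆ᵇ-complete S (swapV a b x) ∘ ⊆-swapV⁻ ∘ ⊆ᵇ-sound (swapV a b S) x

  AND-invariant : ∀ (a b : Fin n) S x → lookup S a ≡ lookup S b → AND S (swapV a b x) ≡ AND S x
  AND-invariant a b S x Sa≡Sb = trans (AND-swapV a b S x) (cong (λ R → AND R x) (swapV-fixes a b S Sa≡Sb))

  AND-extract : ∀ (S x : Vec Bool n) i → lookup S i ≡ true → AND S x ≡ b2q (lookup x i) * AND (S [ i ]≔ false) x
  AND-extract (true ∷ S) (y ∷ x) zero    _    = cong (b2q y *_) (sym (ℚ.*-identityˡ (AND S x)))
  AND-extract (s    ∷ S) (y ∷ x) (suc i) Si≡1 = trans (cong (c *_) (AND-extract S x i Si≡1))
    (solve 3 (λ c p q → c :* (p :* q) := p :* (c :* q)) refl c (b2q (lookup x i)) (AND (S [ i ]≔ false) x))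
    where
    c = if s then b2q y else 1ℚ

  AND-empty : ∀ (S x : Vec Bool n) → ∣ S ∣ ≡ 0 → AND S x ≡ 1ℚ
  AND-empty []          []      _      = refl
  AND-empty (false ∷ S) (_ ∷ x) ∣S∣≡0 = trans (ℚ.*-identityˡ _) (AND-empty S x ∣S∣≡0)

  AND-self : ∀ (x : Vec Bool n) → AND x x ≡ 1ℚ
  AND-self []          = refl
  AND-self (true  ∷ x) = trans (ℚ.*-identityˡ _) (AND-self x)
  AND-self (false ∷ x) = trans (ℚ.*-identityˡ _) (AND-self x)

  AND-vanishes : ∀ (x y : Vec Bool n) → countT y ℕ.≤ countT x → x ≢ y → AND x y ≡ 0ℚ
  AND-vanishes []          []          _  x≢y = ⊥-elim (x≢y refl)
  AND-vanishes (true  ∷ x) (false ∷ y) _  _   = ℚ.*-zeroˡ (AND x y)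
  AND-vanishes (true  ∷ x) (true  ∷ y) (s≤s y≤x) x≢y =
    trans (ℚ.*-identityˡ _) (AND-vanishes x y y≤x (x≢y ∘ cong (true ∷_)))
  AND-vanishes (false ∷ x) (false ∷ y) y≤x x≢y =
    trans (ℚ.*-identityˡ _) (AND-vanishes x y y≤x (x≢y ∘ cong (false ∷_)))
  AND-vanishes (false ∷ x) (true  ∷ y) y<x _ =
    trans (ℚ.*-identityˡ _) (AND-vanishes x y (ℕ.<⇒≤ y<x) (λ { refl → ℕ.<-irrefl refl y<x }))

  infixl 6 _+ᶠ_ _-ᶠ_
  infixl 7 _·ᶠ_ _*ᶠ_

  _+ᶠ_ _-ᶠ_ _*ᶠ_ : Fun n → Fun n → Fun n
  (f +ᶠ g) x = f x + g x
  (f -ᶠ g) x = f x - g x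
  (f *ᶠ g) x = f x * g x

  _·ᶠ_ : ℚ → Fun n → Fun n
  (c ·ᶠ f) x = c * f x

  -- The operators D and D_P

  Pairs : ℕ → Set
  Pairs n = List (Fin n × Fin n)

  Invariant : Fin n → Fin n → Fun n → Set
  Invariant a b g = ∀ y → g (swapV a b y) ≡ g y

  module _ (a b : Fin n) where

    D-cong : ∀ {f g} → f ≗ g → D a b f ≗ D a b g
    D-cong f≗g x = cong₂ (λ u v → ½ * (u - v)) (f≗g x) (f≗g (swapV a b x))

    D-+ : ∀ f g → D a b (f +ᶠ g) ≗ D a b f +ᶠ D a b g
    D-+ f g x = solve 4 (λ p q r s → con ½ :* ((p :+ q) :- (r :+ s)) := con ½ :* (p :- r) :+ con ½ :* (q :- s))
      refl (f x) (g x) (f (swapV a b x)) (g (swapV a b x))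

    D-· : ∀ c f → D a b (c ·ᶠ f) ≗ c ·ᶠ D a b f
    D-· c f x = solve 3 (λ c p q → con ½ :* (c :* p :- c :* q) := c :* (con ½ :* (p :- q))) refl c (f x) (f (swapV a b x))

    D-annihilates : ∀ {g} → Invariant a b g → D a b g ≗ zeroF
    D-annihilates {g} inv x = trans (cong (λ u → ½ * (g x - u)) (inv x))
      (trans (cong (½ *_) (ℚ.+-inverseʳ (g x))) (ℚ.*-zeroʳ ½))

    D-invariant-factor : ∀ {h} g → Invariant a b h → D a b (h *ᶠ g) ≗ h *ᶠ D a b g
    D-invariant-factor {h} g inv x = trans (cong (λ u → ½ * (h x * g x - u * g (swapV a b x))) (inv x))
      (solve 3 (λ p q r → con ½ :* (p :* q :- p :* r) := p :* (con ½ :* (q :- r))) refl (h x) (g x) (g (swapV a b x)))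

  D-invariant : ∀ {a b c d : Fin n} → a ≢ c → a ≢ d → b ≢ c → b ≢ d → ∀ {g} →
    Invariant a b g → Invariant a b (D c d g)
  D-invariant {c = c} {d} a≢c a≢d b≢c b≢d {g} inv y = cong₂ (λ u v → ½ * (u - v)) (inv y)
    (trans (cong g (swapV-comm a≢c a≢d b≢c b≢d y)) (inv (swapV c d y)))

  DP-cong : ∀ (P : Pairs n) {f g} → f ≗ g → DP P f ≗ DP P g
  DP-cong []            f≗g = f≗g
  DP-cong ((a , b) ∷ P) f≗g = DP-cong P (D-cong a b f≗g)

  DP-+ : ∀ (P : Pairs n) f g → DP P (f +ᶠ g) ≗ DP P f +ᶠ DP P g
  DP-+ []            f g x = refl
  DP-+ ((a , b) ∷ P) f g x = trans (DP-cong P (D-+ a b f g) x) (DP-+ P (D a b f) (D a b g) x)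

  DP-· : ∀ (P : Pairs n) c f → DP P (c ·ᶠ f) ≗ c ·ᶠ DP P f
  DP-· []            c f x = refl
  DP-· ((a , b) ∷ P) c f x = trans (DP-cong P (D-· a b c f) x) (DP-· P c (D a b f) x)

  DP-zero : ∀ (P : Pairs n) {f} → f ≗ zeroF → DP P f ≗ zeroF
  DP-zero P {f} f≗0 x = begin
    DP P f x          ≡⟨ DP-cong P (λ y → trans (f≗0 y) (sym (ℚ.*-zeroˡ (f y)))) x ⟩
    DP P (0ℚ ·ᶠ f) x  ≡⟨ DP-· P 0ℚ f x ⟩
    0ℚ * DP P f x     ≡⟨ ℚ.*-zeroˡ (DP P f x) ⟩
    0ℚ                ∎
    where open ≡-Reasoning

  DP-invariant-factor : ∀ (P : Pairs n) {h} g → All (λ (a , b) → Invariant a b h) P → DP P (h *ᶠ g) ≗ h *ᶠ DP P g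
  DP-invariant-factor []            g []           x = refl
  DP-invariant-factor ((a , b) ∷ P) g (inv ∷ invs) x =
    trans (DP-cong P (D-invariant-factor a b g inv) x) (DP-invariant-factor P (D a b g) invs x)

  ∈-pairElems : ∀ {P : Pairs n} {a b} → (a , b) ∈ P → a ∈ pairElems P × b ∈ pairElems P
  ∈-pairElems (here refl) = here refl , there (here refl)
  ∈-pairElems {P = _ ∷ P} (there ab∈P) = let a∈ , b∈ = ∈-pairElems ab∈P in there (there a∈) , there (there b∈)

  DP-annihilates : ∀ (P : Pairs n) → Unique (pairElems P) → ∀ {a b g} → (a , b) ∈ P → Invariant a b g → DP P g ≗ zeroF
  DP-annihilates ((a , b) ∷ P) _ (here refl) inv = DP-zero P (D-annihilates a b inv)
  DP-annihilates ((c , d) ∷ P) (c∉ ∷ d∉ ∷ unique) (there ab∈P) inv =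
    DP-annihilates P unique ab∈P (D-invariant (≢c a∈) (≢d a∈) (≢c b∈) (≢d b∈) inv)
    where
    a∈ = proj₁ (∈-pairElems ab∈P)
    b∈ = proj₂ (∈-pairElems ab∈P)
    ≢c : ∀ {t} → t ∈ pairElems P → t ≢ c
    ≢c t∈ = All.lookup (All.tail c∉) t∈ ∘ sym
    ≢d : ∀ {t} → t ∈ pairElems P → t ≢ d
    ≢d t∈ = All.lookup d∉ t∈ ∘ sym

  -- D_P on monomials

  signed : Sign → ℚ → ℚ
  signed Sign.+ q = q
  signed Sign.- q = - q

  signed-* : ∀ s t p q → signed s p * signed t q ≡ signed (s Sign.* t) (p * q)
  signed-* Sign.+ Sign.+ p q = refl
  signed-* Sign.+ Sign.- p q = solve 2 (λ p q → p :* (:- q) := :- (p :* q)) refl p q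
  signed-* Sign.- Sign.+ p q = solve 2 (λ p q → (:- p) :* q := :- (p :* q)) refl p q
  signed-* Sign.- Sign.- p q = solve 2 (λ p q → (:- p) :* (:- q) := p :* q) refl p q

  D-AND-remove : ∀ (a b : Fin n) T c → lookup T c ≡ true →
    lookup (T [ c ]≔ false) a ≡ lookup (T [ c ]≔ false) b →
    D a b (AND T) ≗ (λ y → ½ * (b2q (lookup y c) - b2q (lookup (swapV a b y) c))) *ᶠ AND (T [ c ]≔ false)
  D-AND-remove a b T c Tc≡1 T′a≡T′b y = begin
    ½ * (AND T y - AND T (swapV a b y))
      ≡⟨ cong₂ (λ u v → ½ * (u - v)) (AND-extract T y c Tc≡1) (AND-extract T (swapV a b y) c Tc≡1) ⟩
    ½ * (b2q yc * AND T′ y - b2q y′c * AND T′ (swapV a b y))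
      ≡⟨ cong (λ u → ½ * (b2q yc * AND T′ y - b2q y′c * u)) (AND-invariant a b T′ y T′a≡T′b) ⟩
    ½ * (b2q yc * AND T′ y - b2q y′c * AND T′ y)
      ≡⟨ solve 3 (λ p q r → con ½ :* (p :* r :- q :* r) := (con ½ :* (p :- q)) :* r) refl (b2q yc) (b2q y′c) (AND T′ y) ⟩
    ½ * (b2q yc - b2q y′c) * AND T′ y ∎
    where
    open ≡-Reasoning
    T′ = T [ c ]≔ false
    yc = lookup y c
    y′c = lookup (swapV a b y) c

  D-AND-pair : ∀ {a b : Fin n} T → a ≢ b → (lookup T a xor lookup T b) ≡ true →
    ∃₂ λ (s : Sign) (T′ : Subset n) → ∣ T ∣ ≡ suc ∣ T′ ∣ ×
      (∀ {t} → t ≢ a → t ≢ b → lookup T′ t ≡ lookup T t) ×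
      D a b (AND T) ≗ (λ y → signed s (½ * (b2q (lookup y b) - b2q (lookup y a)))) *ᶠ AND T′
  D-AND-pair {a = a} {b} T a≢b one with lookup T a in Ta | lookup T b in Tb
  ... | true | false = Sign.- , T′ , ∣∣-remove T a Ta , agree , λ y → begin
    D a b (AND T) y                                              ≡⟨ D-AND-remove a b T a Ta T′a≡T′b y ⟩
    ½ * (b2q (lookup y a) - b2q (lookup (swapV a b y) a)) * AND T′ y
      ≡⟨ cong (λ v → ½ * (b2q (lookup y a) - b2q v) * AND T′ y) (lookup-swapV-first a b y) ⟩
    ½ * (b2q (lookup y a) - b2q (lookup y b)) * AND T′ y
      ≡⟨ cong (_* AND T′ y) (solve 2 (λ p q → con ½ :* (p :- q) := :- (con ½ :* (q :- p))) refl
                                     (b2q (lookup y a)) (b2q (lookup y b))) ⟩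
    - (½ * (b2q (lookup y b) - b2q (lookup y a))) * AND T′ y     ∎
    where
    open ≡-Reasoning
    T′ = T [ a ]≔ false
    agree : ∀ {t} → t ≢ a → t ≢ b → lookup T′ t ≡ lookup T t
    agree t≢a _ = Vec.lookup∘update′ t≢a T false
    T′a≡T′b : lookup T′ a ≡ lookup T′ b
    T′a≡T′b = trans (Vec.lookup∘update a T false) (sym (trans (Vec.lookup∘update′ (a≢b ∘ sym) T false) Tb))
  ... | false | true = Sign.+ , T′ , ∣∣-remove T b Tb , agree , λ y →
    trans (D-AND-remove a b T b Tb T′a≡T′b y)
          (cong (λ v → ½ * (b2q (lookup y b) - b2q v) * AND T′ y) (lookup-swapV-second a b y))
    where
    T′ = T [ b ]≔ false
    agree : ∀ {t} → t ≢ a → t ≢ b → lookup T′ t ≡ lookup T t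
    agree _ t≢b = Vec.lookup∘update′ t≢b T false
    T′a≡T′b : lookup T′ a ≡ lookup T′ b
    T′a≡T′b = trans (trans (Vec.lookup∘update′ a≢b T false) Ta) (sym (Vec.lookup∘update b T false))

  EachPairOne-agree : ∀ (P : Pairs n) {T T′} → All (λ t → lookup T′ t ≡ lookup T t) (pairElems P) →
    EachPairOne T P → EachPairOne T′ P
  EachPairOne-agree []            _                  []           = []
  EachPairOne-agree ((a , b) ∷ P) {T} {T′} (T′a ∷ T′b ∷ agree) (one ∷ each) =
    subst₂ (λ u v → (u xor v) ≡ true) (sym T′a) (sym T′b) one ∷ EachPairOne-agree P {T} {T′} agree each

  coordinates-invariant : ∀ {a b : Fin n} (H : Bool → Bool → ℚ) (P : Pairs n) →
    All (a ≢_) (pairElems P) → All (b ≢_) (pairElems P) →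
    All (λ (c , d) → Invariant c d (λ y → H (lookup y a) (lookup y b))) P
  coordinates-invariant H []            _                   _                   = []
  coordinates-invariant H ((c , d) ∷ P) (a≢c ∷ a≢d ∷ a∉) (b≢c ∷ b≢d ∷ b∉) =
    (λ y → cong₂ H (lookup-swapV-elsewhere c d y a≢c a≢d) (lookup-swapV-elsewhere c d y b≢c b≢d))
    ∷ coordinates-invariant H P a∉ b∉

  -- R is T with the elements of P removed.
  DP-AND-EachPairOne : ∀ (P : Pairs n) → Unique (pairElems P) → ∀ T → EachPairOne T P →
    ∃₂ λ (s : Sign) (R : Subset n) → ∣ T ∣ ≡ length P ℕ.+ ∣ R ∣ ×
      DP P (AND T) ≗ (λ x → signed s (half^ (length P) * (Ψ P x * AND R x)))
  DP-AND-EachPairOne [] _ T [] = Sign.+ , T , refl , λ x → sym (trans (ℚ.*-identityˡ _) (ℚ.*-identityˡ _))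
  DP-AND-EachPairOne ((a , b) ∷ P) (a∉ ∷ b∉ ∷ unique) T (one ∷ each)
    with D-AND-pair T (All.head a∉) one
  ... | s₁ , T₁ , ∣T∣≡ , agree , D≗
    with DP-AND-EachPairOne P unique T₁ (EachPairOne-agree P {T} {T₁}
           (All.zipWith (λ (a≢t , b≢t) → agree (a≢t ∘ sym) (b≢t ∘ sym)) (All.tail a∉ , b∉)) each)
  ... | s₂ , R , ∣T₁∣≡ , DP≗ = s₁ Sign.* s₂ , R , trans ∣T∣≡ (cong suc ∣T₁∣≡) , λ x → begin
    DP P (D a b (AND T)) x             ≡⟨ DP-cong P D≗ x ⟩
    DP P (h *ᶠ AND T₁) x               ≡⟨ DP-invariant-factor P (AND T₁) h-invariant x ⟩
    h x * DP P (AND T₁) x              ≡⟨ cong (h x *_) (DP≗ x) ⟩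
    h x * signed s₂ (half^ k * (Ψ P x * AND R x))
      ≡⟨ signed-* s₁ s₂ _ _ ⟩
    signed (s₁ Sign.* s₂) (½ * u x * (half^ k * (Ψ P x * AND R x)))
      ≡⟨ cong (signed (s₁ Sign.* s₂))
           (solve 4 (λ u h ψ r → con ½ :* u :* (h :* (ψ :* r)) := con ½ :* h :* (u :* ψ :* r)) refl
                  (u x) (half^ k) (Ψ P x) (AND R x)) ⟩
    signed (s₁ Sign.* s₂) (half^ (suc k) * (Ψ ((a , b) ∷ P) x * AND R x)) ∎
    where
    open ≡-Reasoning
    k = length P
    u : Fun _
    u y = b2q (lookup y b) - b2q (lookup y a)
    h : Fun _
    h y = signed s₁ (½ * u y)
    h-invariant : All (λ (c , d) → Invariant c d h) P
    h-invariant = coordinates-invariant (λ ya yb → signed s₁ (½ * (b2q yb - b2q ya))) P (All.tail a∉) b∉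

  EachPairOne? : ∀ (T : Subset n) P → Dec (EachPairOne T P)
  EachPairOne? T = All.all? (λ (a , b) → (lookup T a xor lookup T b) Bool.≟ true)

  ¬EachPairOne⇒balanced-pair : ∀ (T : Subset n) P → ¬ EachPairOne T P →
    ∃ λ ((a , b) : Fin n × Fin n) → (a , b) ∈ P × lookup T a ≡ lookup T b
  ¬EachPairOne⇒balanced-pair T P ¬each =
    let (a , b) , ab∈P , ¬one = find (¬All⇒Any¬ (λ (a , b) → (lookup T a xor lookup T b) Bool.≟ true) P ¬each)
    in (a , b) , ab∈P , balanced (lookup T a) (lookup T b) ¬one
    where
    balanced : ∀ u v → ¬ (u xor v) ≡ true → u ≡ v
    balanced false false _   = refl
    balanced false true  ¬one = ⊥-elim (¬one refl)
    balanced true  false ¬one = ⊥-elim (¬one refl)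
    balanced true  true  _   = refl

  module _ (P : Pairs n) (unique : Unique (pairElems P)) (T : Subset n) where

    DP-AND-¬EachPairOne : ¬ EachPairOne T P → DP P (AND T) ≗ zeroF
    DP-AND-¬EachPairOne ¬each =
      let (a , b) , ab∈P , Ta≡Tb = ¬EachPairOne⇒balanced-pair T P ¬each
      in DP-annihilates P unique ab∈P (λ y → AND-invariant a b T y Ta≡Tb)

    DP-AND-low-degree : ∣ T ∣ ℕ.< length P → DP P (AND T) ≗ zeroF
    DP-AND-low-degree ∣T∣<k with EachPairOne? T P
    ... | no ¬each = DP-AND-¬EachPairOne ¬each
    ... | yes each =
      let _ , R , ∣T∣≡k+∣R∣ , _ = DP-AND-EachPairOne P unique T each
      in ⊥-elim (ℕ.<⇒≱ ∣T∣<k (ℕ.≤-trans (ℕ.m≤m+n _ ∣ R ∣) (ℕ.≤-reflexive (sym ∣T∣≡k+∣R∣))))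

    DP-AND-top-degree : ∣ T ∣ ≡ length P → EachPairOne T P →
      DP P (AND T) ≗ (λ x → half^ (length P) * Ψ P x) ⊎ DP P (AND T) ≗ (λ x → - (half^ (length P) * Ψ P x))
    DP-AND-top-degree ∣T∣≡k each with DP-AND-EachPairOne P unique T each
    ... | s , R , ∣T∣≡k+∣R∣ , DP≗ = by-sign s DP≗
      where
      ∣R∣≡0 : ∣ R ∣ ≡ 0
      ∣R∣≡0 = ℕ.+-cancelˡ-≡ (length P) ∣ R ∣ 0 (trans (sym ∣T∣≡k+∣R∣) (trans ∣T∣≡k (sym (ℕ.+-identityʳ _))))
      Ψ*AND-R : ∀ x → Ψ P x * AND R x ≡ Ψ P x
      Ψ*AND-R x = trans (cong (Ψ P x *_) (AND-empty R x ∣R∣≡0)) (ℚ.*-identityʳ _)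
      by-sign : ∀ s → DP P (AND T) ≗ (λ x → signed s (half^ (length P) * (Ψ P x * AND R x))) →
        DP P (AND T) ≗ (λ x → half^ (length P) * Ψ P x) ⊎ DP P (AND T) ≗ (λ x → - (half^ (length P) * Ψ P x))
      by-sign Sign.+ DP≗ = inj₁ λ x → trans (DP≗ x) (cong (half^ (length P) *_) (Ψ*AND-R x))
      by-sign Sign.- DP≗ = inj₂ λ x → trans (DP≗ x) (cong (λ z → - (half^ (length P) * z)) (Ψ*AND-R x))

  -- Linear algebra on the slice

  module OnSlice (n m : ℕ) where

    infix 4 _≈_ _⊥_

    _≈_ : Fun n → Fun n → Set
    f ≈ g = f ≈[ m ] g

    ⟨_,_⟩ : Fun n → Fun n → ℚ
    ⟨ f , g ⟩ = inner m f g

    _⊥_ : Fun n → (Fun n → Set) → Set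
    f ⊥ V = ∀ u → V u → f ⊥[ m ] u

    -- L d is spanned by the AND_S with |S| < d: the paper's L_{d-1}.
    L : ℕ → Fun n → Set
    L = InL< m

    ≗⇒≈ : ∀ {f g} → f ≗ g → f ≈ g
    ≗⇒≈ f≗g x _ = f≗g x

    ≈-refl : ∀ {f} → f ≈ f
    ≈-refl _ _ = refl

    ≈-trans : ∀ {f g h} → f ≈ g → g ≈ h → f ≈ h
    ≈-trans f≈g g≈h x x∈ = trans (f≈g x x∈) (g≈h x x∈)

    ∈-slice⁻ : ∀ {x} → x ∈ slice n m → countT x ≡ m
    ∈-slice⁻ = proj₂ ∘ ∈-filter⁻ (λ x → countT x ℕ.≟ m) {xs = allVecs n}

    ∈-slice⁺ : ∀ {x} → countT x ≡ m → x ∈ slice n m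
    ∈-slice⁺ {x} = ∈-filter⁺ (λ x → countT x ℕ.≟ m) (allVecs-complete x)

    ⟨⟩-comm : ∀ f g → ⟨ f , g ⟩ ≡ ⟨ g , f ⟩
    ⟨⟩-comm f g = sumℚ-map-cong (slice n m) (λ {x} _ → ℚ.*-comm (f x) (g x))

    ⟨⟩-congˡ : ∀ {f f′} g → f ≈ f′ → ⟨ f , g ⟩ ≡ ⟨ f′ , g ⟩
    ⟨⟩-congˡ g f≈f′ = sumℚ-map-cong (slice n m) (λ {x} x∈ → cong (_* g x) (f≈f′ x (∈-slice⁻ x∈)))

    ⟨⟩-congʳ : ∀ f {g g′} → g ≈ g′ → ⟨ f , g ⟩ ≡ ⟨ f , g′ ⟩
    ⟨⟩-congʳ f {g} {g′} g≈g′ = trans (⟨⟩-comm f g) (trans (⟨⟩-congˡ f g≈g′) (⟨⟩-comm g′ f))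

    ⟨⟩-+ˡ : ∀ f g h → ⟨ f +ᶠ g , h ⟩ ≡ ⟨ f , h ⟩ + ⟨ g , h ⟩
    ⟨⟩-+ˡ f g h = trans (sumℚ-map-cong (slice n m) (λ {x} _ → ℚ.*-distribʳ-+ (h x) (f x) (g x)))
                        (sumℚ-map-+ (f *ᶠ h) (g *ᶠ h) (slice n m))

    ⟨⟩-·ˡ : ∀ c f h → ⟨ c ·ᶠ f , h ⟩ ≡ c * ⟨ f , h ⟩
    ⟨⟩-·ˡ c f h = trans (sumℚ-map-cong (slice n m) (λ {x} _ → ℚ.*-assoc c (f x) (h x)))
                        (sumℚ-map-* c (f *ᶠ h) (slice n m))

    ⟨⟩-diffˡ : ∀ f g h → ⟨ f -ᶠ g , h ⟩ ≡ ⟨ f , h ⟩ - ⟨ g , h ⟩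
    ⟨⟩-diffˡ f g h = begin
      ⟨ f -ᶠ g , h ⟩
        ≡⟨ ⟨⟩-congˡ h (≗⇒≈ λ x → solve 2 (λ a b → a :- b := a :+ con (- 1ℚ) :* b) refl (f x) (g x)) ⟩
      ⟨ f +ᶠ (- 1ℚ) ·ᶠ g , h ⟩
        ≡⟨ trans (⟨⟩-+ˡ f _ h) (cong (⟨ f , h ⟩ +_) (⟨⟩-·ˡ (- 1ℚ) g h)) ⟩
      ⟨ f , h ⟩ + - 1ℚ * ⟨ g , h ⟩
        ≡⟨ solve 2 (λ a b → a :+ con (- 1ℚ) :* b := a :- b) refl ⟨ f , h ⟩ ⟨ g , h ⟩ ⟩
      ⟨ f , h ⟩ - ⟨ g , h ⟩ ∎
      where open ≡-Reasoning

    ⟨⟩-+ʳ : ∀ f g h → ⟨ h , f +ᶠ g ⟩ ≡ ⟨ h , f ⟩ + ⟨ h , g ⟩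
    ⟨⟩-+ʳ f g h = trans (⟨⟩-comm h _) (trans (⟨⟩-+ˡ f g h) (cong₂ _+_ (⟨⟩-comm f h) (⟨⟩-comm g h)))

    ⟨⟩-·ʳ : ∀ c f h → ⟨ h , c ·ᶠ f ⟩ ≡ c * ⟨ h , f ⟩
    ⟨⟩-·ʳ c f h = trans (⟨⟩-comm h _) (trans (⟨⟩-·ˡ c f h) (cong (c *_) (⟨⟩-comm f h)))

    ⟨⟩-zeroʳ : ∀ f {g} → g ≈ zeroF → ⟨ f , g ⟩ ≡ 0ℚ
    ⟨⟩-zeroʳ f {g} g≈0 = trans (⟨⟩-congʳ f g≈0) (sumℚ-map-zero (slice n m) (λ {x} _ → ℚ.*-zeroʳ (f x)))

    ⟨⟩-sumTo : ∀ N (a : ℕ → Fun n) h → ⟨ (λ x → sumTo N (λ e → a e x)) , h ⟩ ≡ sumTo N (λ e → ⟨ a e , h ⟩)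
    ⟨⟩-sumTo zero    a h = trans (⟨⟩-comm zeroF h) (⟨⟩-zeroʳ h ≈-refl)
    ⟨⟩-sumTo (suc N) a h = trans (⟨⟩-+ˡ (λ x → sumTo N (λ e → a e x)) (a N) h) (cong (_+ ⟨ a N , h ⟩) (⟨⟩-sumTo N a h))

    ⟨⟩-definite : ∀ f → ⟨ f , f ⟩ ≡ 0ℚ → f ≈ zeroF
    ⟨⟩-definite f ⟨f,f⟩≡0 x x∈ = sumℚ-squares≡0 f (slice n m) ⟨f,f⟩≡0 (∈-slice⁺ x∈)

    comb : List (Subset n × ℚ) → Fun n
    comb cs x = sumℚ (map (λ sc → proj₂ sc * AND (proj₁ sc) x) cs)

    L-≈ : ∀ {d f g} → f ≈ g → L d g → L d f
    L-≈ f≈g (cs , deg , g≈comb) = cs , deg , ≈-trans f≈g g≈comb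

    L-zero : ∀ {d} → L d zeroF
    L-zero = [] , [] , ≈-refl

    L-+ : ∀ {d f g} → L d f → L d g → L d (f +ᶠ g)
    L-+ (cs , deg , f≈) (ds , deg′ , g≈) = cs ++ ds , ++⁺ deg deg′ , λ x x∈ →
      trans (cong₂ _+_ (f≈ x x∈) (g≈ x x∈))
            (sym (trans (cong sumℚ (Listₚ.map-++ _ cs ds)) (sumℚ-++ (map _ cs) _)))

    L-· : ∀ {d} c {f} → L d f → L d (c ·ᶠ f)
    L-· c (cs , deg , f≈) = map (λ (S , a) → S , c * a) cs , map⁺ deg , λ x x∈ →
      trans (cong (c *_) (f≈ x x∈)) (sym (begin
        sumℚ (map _ (map (λ (S , a) → S , c * a) cs))            ≡⟨ cong sumℚ (Listₚ.map-∘ cs) ⟨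
        sumℚ (map (λ (S , a) → c * a * AND S x) cs)             ≡⟨ sumℚ-map-cong cs (λ {(S , a)} _ → ℚ.*-assoc c a (AND S x)) ⟩
        sumℚ (map (λ (S , a) → c * (a * AND S x)) cs)           ≡⟨ sumℚ-map-* c (λ (S , a) → a * AND S x) cs ⟩
        c * comb cs x                                           ∎))
      where open ≡-Reasoning

    L-diff : ∀ {d f g} → L d f → L d g → L d (f -ᶠ g)
    L-diff {f = f} {g} Lf Lg = L-≈ (≗⇒≈ λ x → solve 2 (λ a b → a :- b := a :+ con (- 1ℚ) :* b) refl (f x) (g x))
                               (L-+ Lf (L-· (- 1ℚ) Lg))

    L-mono : ∀ {d d′ f} → d ℕ.≤ d′ → L d f → L d′ f
    L-mono d≤d′ (cs , deg , f≈) = cs , All.map (λ lt → ℕ.<-≤-trans lt d≤d′) deg , f≈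

    L-AND : ∀ {d} S → ∣ S ∣ ℕ.< d → L d (AND S)
    L-AND S ∣S∣<d = (S , 1ℚ) ∷ [] , ∣S∣<d ∷ [] , ≗⇒≈ λ x → sym (trans (ℚ.+-identityʳ _) (ℚ.*-identityˡ _))

    L-sumTo : ∀ {d} N (a : ℕ → Fun n) → (∀ {e} → e ℕ.< N → L d (a e)) → L d (λ x → sumTo N (λ e → a e x))
    L-sumTo zero    a La = L-zero
    L-sumTo (suc N) a La = L-+ (L-sumTo N a (La ∘ ℕ.m<n⇒m<1+n)) (La (ℕ.n<1+n N))

    L-zero-degree : ∀ {f} → L 0 f → f ≈ zeroF
    L-zero-degree ([] , [] , f≈0) = f≈0

    -- On the slice AND x is the indicator of x, so f = Σ_x f(x) AND_x.
    L-everything : ∀ f → L (suc n) f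
    L-everything f = cs , map⁺ (All.universal (λ x → s≤s (∣p∣≤n x)) (slice n m)) , f≈comb
      where
      cs = map (λ x → x , f x) (slice n m)
      f≈comb : f ≈ comb cs
      f≈comb y y∈ = sym (begin
        comb cs y
          ≡⟨ cong sumℚ (Listₚ.map-∘ (slice n m)) ⟨
        sumℚ (map (λ x → f x * AND x y) (slice n m))
          ≡⟨ sumℚ-map-filter (λ x → countT x ℕ.≟ m) _ (allVecs n) ⟩
        sumℚ (map (λ x → if does (countT x ℕ.≟ m) then f x * AND x y else 0ℚ) (allVecs n))
          ≡⟨ sumℚ-allVecs-single n _ y off-y ⟩
        (if does (countT y ℕ.≟ m) then f y * AND y y else 0ℚ)
          ≡⟨ at-y ⟩
        f y ∎)
        where
        open ≡-Reasoning
        off-y : ∀ x → x ≢ y → (if does (countT x ℕ.≟ m) then f x * AND x y else 0ℚ) ≡ 0ℚ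
        off-y x x≢y = if-does (countT x ℕ.≟ m)
          (λ x∈ → trans (cong (f x *_) (AND-vanishes x y (ℕ.≤-reflexive (trans y∈ (sym x∈))) x≢y)) (ℚ.*-zeroʳ (f x)))
          (λ _ → refl)
        at-y : (if does (countT y ℕ.≟ m) then f y * AND y y else 0ℚ) ≡ f y
        at-y = if-does (countT y ℕ.≟ m) (λ _ → trans (cong (f y *_) (AND-self y)) (ℚ.*-identityʳ (f y)))
                                         (λ y∉ → ⊥-elim (y∉ y∈))

    record Subspace (V : Fun n → Set) : Set where
      field
        ∋-≈    : ∀ {f g} → f ≈ g → V g → V f
        ∋-zero : V zeroF
        ∋-+    : ∀ {f g} → V f → V g → V (f +ᶠ g)
        ∋-·    : ∀ c {f} → V f → V (c ·ᶠ f)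

    record Linear (Φ : Fun n → Fun n) : Set where
      field
        resp-≈ : ∀ {f g} → f ≈ g → Φ f ≈ Φ g
        +-hom  : ∀ f g → Φ (f +ᶠ g) ≈ Φ f +ᶠ Φ g
        ·-hom  : ∀ c f → Φ (c ·ᶠ f) ≈ c ·ᶠ Φ f

    L-subspace : ∀ d → Subspace (L d)
    L-subspace d = record { ∋-≈ = L-≈ ; ∋-zero = L-zero ; ∋-+ = L-+ ; ∋-· = L-· }

    preimage-subspace : ∀ {Φ V} → Linear Φ → Subspace V → Subspace (λ f → V (Φ f))
    preimage-subspace {Φ} {V} lin sub = record
      { ∋-≈    = λ f≈g → ∋-≈ (resp-≈ f≈g)
      ; ∋-zero = ∋-≈ Φ0≈0 ∋-zero
      ; ∋-+    = λ {f} {g} Vf Vg → ∋-≈ (+-hom f g) (∋-+ Vf Vg)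
      ; ∋-·    = λ c {f} Vf → ∋-≈ (·-hom c f) (∋-· c Vf)
      }
      where
      open Linear lin
      open Subspace sub
      Φ0≈0 : Φ zeroF ≈ zeroF
      Φ0≈0 x x∈ = trans (resp-≈ {zeroF} {0ℚ ·ᶠ zeroF} ≈-refl x x∈)
                        (trans (·-hom 0ℚ zeroF x x∈) (ℚ.*-zeroˡ (Φ zeroF x)))

    L-induction : ∀ {V d} → Subspace V → (∀ S → ∣ S ∣ ℕ.< d → V (AND S)) → ∀ {f} → L d f → V f
    L-induction {V} {d} sub V-AND (cs , deg , f≈comb) = ∋-≈ f≈comb (on-comb cs deg)
      where
      open Subspace sub
      on-comb : ∀ cs → All (λ sc → ∣ proj₁ sc ∣ ℕ.< d) cs → V (comb cs)
      on-comb []             []            = ∋-zero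
      on-comb ((S , c) ∷ cs) (∣S∣<d ∷ deg) = ∋-+ (∋-· c (V-AND S ∣S∣<d)) (on-comb cs deg)

    D-≈ : ∀ a b {f g} → f ≈ g → D a b f ≈ D a b g
    D-≈ a b f≈g x x∈ = cong₂ (λ u v → ½ * (u - v)) (f≈g x x∈) (f≈g (swapV a b x) (trans (countT-swapV a b x) x∈))

    DP-≈ : ∀ P {f g} → f ≈ g → DP P f ≈ DP P g
    DP-≈ []            f≈g = f≈g
    DP-≈ ((a , b) ∷ P) f≈g = DP-≈ P (D-≈ a b f≈g)

    DP-linear : ∀ P → Linear (DP P)
    DP-linear P = record
      { resp-≈ = DP-≈ P
      ; +-hom  = λ f g → ≗⇒≈ (DP-+ P f g)
      ; ·-hom  = λ c f → ≗⇒≈ (DP-· P c f)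
      }

    D-linear : ∀ a b → Linear (D a b)
    D-linear a b = DP-linear ((a , b) ∷ [])

    L-D : ∀ {d} a b {f} → L d f → L d (D a b f)
    L-D {d} a b = L-induction (preimage-subspace (D-linear a b) (L-subspace d)) L-D-AND
      where
      L-D-AND : ∀ S → ∣ S ∣ ℕ.< d → L d (D a b (AND S))
      L-D-AND S ∣S∣<d = L-≈ (≗⇒≈ λ x → cong (λ u → ½ * (AND S x - u)) (AND-swapV a b S x))
        (L-· ½ (L-diff (L-AND S ∣S∣<d) (L-AND (swapV a b S) (subst (ℕ._< d) (sym (∣swapV∣ a b S)) ∣S∣<d))))

    L-DP : ∀ {d} P {f} → L d f → L d (DP P f)
    L-DP []            Lf = Lf
    L-DP ((a , b) ∷ P) Lf = L-DP P (L-D a b Lf)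

    DP-kills-L : ∀ P → Unique (pairElems P) → ∀ {f} → L (length P) f → DP P f ≈ zeroF
    DP-kills-L P unique Lf = L-zero-degree (L-induction (preimage-subspace (DP-linear P) (L-subspace 0)) DP-AND Lf)
      where
      DP-AND : ∀ S → ∣ S ∣ ℕ.< length P → L 0 (DP P (AND S))
      DP-AND S ∣S∣<k = L-≈ (≗⇒≈ (DP-AND-low-degree P unique S ∣S∣<k)) L-zero

    Span : List (Fun n) → Fun n → Set
    Span []      f = f ≈ zeroF
    Span (v ∷ G) f = Σ ℚ λ c → Σ (Fun n) λ w → Span G w × f ≈ w +ᶠ c ·ᶠ v

    span-≈ : ∀ G {f g} → f ≈ g → Span G g → Span G f
    span-≈ []      f≈g g≈0                 = ≈-trans f≈g g≈0
    span-≈ (v ∷ G) f≈g (c , w , w∈ , g≈)   = c , w , w∈ , ≈-trans f≈g g≈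

    span-zero : ∀ G → Span G zeroF
    span-zero []      = ≈-refl
    span-zero (v ∷ G) = 0ℚ , zeroF , span-zero G , ≗⇒≈ λ x → sym (trans (ℚ.+-identityˡ _) (ℚ.*-zeroˡ (v x)))

    span-+ : ∀ G {f g} → Span G f → Span G g → Span G (f +ᶠ g)
    span-+ [] {f} {g} f≈0 g≈0 x x∈ = trans (cong₂ _+_ (f≈0 x x∈) (g≈0 x x∈)) (ℚ.+-identityˡ 0ℚ)
    span-+ (v ∷ G) (c , w , w∈ , f≈) (c′ , w′ , w′∈ , g≈) = c + c′ , w +ᶠ w′ , span-+ G w∈ w′∈ , λ x x∈ →
      trans (cong₂ _+_ (f≈ x x∈) (g≈ x x∈))
            (solve 5 (λ a b c c′ e → (a :+ c :* e) :+ (b :+ c′ :* e) := (a :+ b) :+ (c :+ c′) :* e) refl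
                   (w x) (w′ x) c c′ (v x))

    span-· : ∀ G c {f} → Span G f → Span G (c ·ᶠ f)
    span-· []      c f≈0 x x∈ = trans (cong (c *_) (f≈0 x x∈)) (ℚ.*-zeroʳ c)
    span-· (v ∷ G) c (c′ , w , w∈ , f≈) = c * c′ , c ·ᶠ w , span-· G c w∈ , λ x x∈ →
      trans (cong (c *_) (f≈ x x∈))
            (solve 4 (λ c a c′ e → c :* (a :+ c′ :* e) := c :* a :+ (c :* c′) :* e) refl c (w x) c′ (v x))

    span-∋ : ∀ G {v} → v ∈ G → Span G v
    span-∋ (v ∷ G) (here refl) = 1ℚ , zeroF , span-zero G ,
      ≗⇒≈ λ x → sym (trans (ℚ.+-identityˡ _) (ℚ.*-identityˡ (v x)))
    span-∋ (w ∷ G) {v} (there v∈G) = 0ℚ , v , span-∋ G v∈G ,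
      ≗⇒≈ λ x → sym (trans (cong (v x +_) (ℚ.*-zeroˡ (w x))) (ℚ.+-identityʳ (v x)))

    Projection : (Fun n → Set) → Fun n → Set
    Projection V h = Σ (Fun n) λ p → V p × (h -ᶠ p) ⊥ V

    span-projection : ∀ G h → Projection (Span G) h
    span-projection []      h = zeroF , ≈-refl , λ u u≈0 → ⟨⟩-zeroʳ (h -ᶠ zeroF) u≈0
    span-projection (v ∷ G) h = extend (span-projection G v) (span-projection G h)
      where
      -- Gram–Schmidt: v′ = v - πv is orthogonal to Span G, and the new projection is πh + c₀ v′
      -- with c₀ ⟨v′,v′⟩ = ⟨h - πh, v′⟩ (c₀ = 0 when v′ ≈ 0).
      extend : Projection (Span G) v → Projection (Span G) h → Projection (Span (v ∷ G)) h
      extend (q , q∈ , v′⊥G) (p₀ , p₀∈ , r₀⊥G) = p , p∈ , r⊥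
        where
        open ≡-Reasoning
        v′ = v -ᶠ q
        r₀ = h -ᶠ p₀
        N = ⟨ v′ , v′ ⟩
        c₀-spec = quotient ⟨ r₀ , v′ ⟩ N (λ N≡0 → ⟨⟩-zeroʳ r₀ (⟨⟩-definite v′ N≡0))
        c₀ = proj₁ c₀-spec
        p = p₀ +ᶠ c₀ ·ᶠ v′
        p∈ : Span (v ∷ G) p
        p∈ = c₀ , p₀ -ᶠ c₀ ·ᶠ q ,
             span-≈ G (≗⇒≈ λ x → solve 3 (λ a b c → a :- c :* b := a :+ (:- c) :* b) refl (p₀ x) (q x) c₀)
                      (span-+ G p₀∈ (span-· G (- c₀) q∈)) ,
             ≗⇒≈ λ x → solve 4 (λ a c e f → a :+ c :* (e :- f) := (a :- c :* f) :+ c :* e) refl (p₀ x) c₀ (v x) (q x)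
        residual : ∀ g → ⟨ h -ᶠ p , g ⟩ ≡ ⟨ r₀ , g ⟩ - c₀ * ⟨ v′ , g ⟩
        residual g = begin
          ⟨ h -ᶠ p , g ⟩
            ≡⟨ ⟨⟩-congˡ g (≗⇒≈ λ x → solve 4 (λ h a c e → h :- (a :+ c :* e) := (h :- a) :- c :* e) refl
                                                (h x) (p₀ x) c₀ (v′ x)) ⟩
          ⟨ r₀ -ᶠ c₀ ·ᶠ v′ , g ⟩     ≡⟨ ⟨⟩-diffˡ r₀ (c₀ ·ᶠ v′) g ⟩
          ⟨ r₀ , g ⟩ - ⟨ c₀ ·ᶠ v′ , g ⟩ ≡⟨ cong (λ z → ⟨ r₀ , g ⟩ - z) (⟨⟩-·ˡ c₀ v′ g) ⟩
          ⟨ r₀ , g ⟩ - c₀ * ⟨ v′ , g ⟩ ∎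
        r⊥G : (h -ᶠ p) ⊥ Span G
        r⊥G w w∈ = begin
          ⟨ h -ᶠ p , w ⟩               ≡⟨ residual w ⟩
          ⟨ r₀ , w ⟩ - c₀ * ⟨ v′ , w ⟩ ≡⟨ cong₂ (λ a b → a - c₀ * b) (r₀⊥G w w∈) (v′⊥G w w∈) ⟩
          0ℚ - c₀ * 0ℚ                 ≡⟨ solve 1 (λ c → con 0ℚ :- c :* con 0ℚ := con 0ℚ) refl c₀ ⟩
          0ℚ                           ∎
        r⊥v : ⟨ h -ᶠ p , v ⟩ ≡ 0ℚ
        r⊥v = begin
          ⟨ h -ᶠ p , v ⟩
            ≡⟨ ⟨⟩-congʳ (h -ᶠ p) (≗⇒≈ λ x → solve 2 (λ a b → a := (a :- b) :+ b) refl (v x) (q x)) ⟩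
          ⟨ h -ᶠ p , v′ +ᶠ q ⟩            ≡⟨ ⟨⟩-+ʳ v′ q (h -ᶠ p) ⟩
          ⟨ h -ᶠ p , v′ ⟩ + ⟨ h -ᶠ p , q ⟩ ≡⟨ cong₂ _+_ (residual v′) (r⊥G q q∈) ⟩
          ⟨ r₀ , v′ ⟩ - c₀ * N + 0ℚ       ≡⟨ cong (λ a → a - c₀ * N + 0ℚ) (proj₂ c₀-spec) ⟩
          c₀ * N - c₀ * N + 0ℚ            ≡⟨ solve 2 (λ c N → c :* N :- c :* N :+ con 0ℚ := con 0ℚ) refl c₀ N ⟩
          0ℚ                              ∎
        r⊥ : (h -ᶠ p) ⊥ Span (v ∷ G)
        r⊥ u (c , w , w∈ , u≈) = begin
          ⟨ h -ᶠ p , u ⟩                     ≡⟨ ⟨⟩-congʳ (h -ᶠ p) u≈ ⟩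
          ⟨ h -ᶠ p , w +ᶠ c ·ᶠ v ⟩           ≡⟨ ⟨⟩-+ʳ w (c ·ᶠ v) (h -ᶠ p) ⟩
          ⟨ h -ᶠ p , w ⟩ + ⟨ h -ᶠ p , c ·ᶠ v ⟩ ≡⟨ cong₂ _+_ (r⊥G w w∈) (trans (⟨⟩-·ʳ c v (h -ᶠ p)) (cong (c *_) r⊥v)) ⟩
          0ℚ + c * 0ℚ                        ≡⟨ solve 1 (λ c → con 0ℚ :+ c :* con 0ℚ := con 0ℚ) refl c ⟩
          0ℚ                                 ∎

    span-subspace : ∀ G → Subspace (Span G)
    span-subspace G = record { ∋-≈ = span-≈ G ; ∋-zero = span-zero G ; ∋-+ = span-+ G ; ∋-· = span-· G }

    generators : ℕ → List (Fun n)
    generators d = map AND (filter (λ S → ∣ S ∣ ℕ.<? d) (allVecs n))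

    L⇒span : ∀ {d f} → L d f → Span (generators d) f
    L⇒span {d} = L-induction (span-subspace (generators d)) λ S ∣S∣<d →
      span-∋ (generators d) (∈-map⁺ AND (∈-filter⁺ (λ S → ∣ S ∣ ℕ.<? d) (allVecs-complete S) ∣S∣<d))

    span-least : ∀ {V} → Subspace V → ∀ G → All V G → ∀ {f} → Span G f → V f
    span-least sub []      []         f≈0                 = ∋-≈ f≈0 ∋-zero
      where open Subspace sub
    span-least sub (v ∷ G) (Vv ∷ VG) (c , w , w∈ , f≈) = ∋-≈ f≈ (∋-+ (span-least sub G VG w∈) (∋-· c Vv))
      where open Subspace sub

    L-projection : ∀ d h → Projection (L d) h
    L-projection d h with span-projection (generators d) h
    ... | p , p∈ , r⊥ = p , span-least (L-subspace d) (generators d) generators-L p∈ , λ u Lu → r⊥ u (L⇒span Lu)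
      where
      generators-L : All (L d) (generators d)
      generators-L = map⁺ (All.map (λ {S} → L-AND S) (all-filter (λ S → ∣ S ∣ ℕ.<? d) (allVecs n)))

    Level : ℕ → Fun n → Set
    Level d w = L (suc d) w × w ⊥ L d

    ⊥-levels⇒⊥-L : ∀ {g} d → (∀ {e} → e ℕ.< d → g ⊥ Level e) → g ⊥ L d
    ⊥-levels⇒⊥-L {g} zero    _    u Lu = ⟨⟩-zeroʳ g (L-zero-degree Lu)
    ⊥-levels⇒⊥-L {g} (suc d) g⊥ u Lu with L-projection d u
    ... | p , Lp , u-p⊥ = begin
      ⟨ g , u ⟩                       ≡⟨ ⟨⟩-congʳ g (≗⇒≈ λ x → solve 2 (λ a b → a := b :+ (a :- b)) refl (u x) (p x)) ⟩
      ⟨ g , p +ᶠ (u -ᶠ p) ⟩           ≡⟨ ⟨⟩-+ʳ p (u -ᶠ p) g ⟩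
      ⟨ g , p ⟩ + ⟨ g , u -ᶠ p ⟩      ≡⟨ cong₂ _+_ (⊥-levels⇒⊥-L {g} d (g⊥ ∘ ℕ.m<n⇒m<1+n) p Lp)
                                                   (g⊥ (ℕ.n<1+n d) (u -ᶠ p) (L-diff Lu (L-mono (ℕ.n≤1+n d) Lp) , u-p⊥)) ⟩
      0ℚ + 0ℚ                         ≡⟨ ℚ.+-identityˡ 0ℚ ⟩
      0ℚ                              ∎
      where open ≡-Reasoning

    levels-orthogonal : ∀ {e d f g w} → IsLevel m e f g → e ≢ d → Level d w → ⟨ g , w ⟩ ≡ 0ℚ
    levels-orthogonal {e} {d} {g = g} {w} (Lg , g⊥ , _) e≢d (Lw , w⊥) with ℕ.<-cmp e d
    ... | tri< e<d _ _ = trans (⟨⟩-comm g w) (w⊥ g (L-mono e<d Lg))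
    ... | tri≈ _ e≡d _ = ⊥-elim (e≢d e≡d)
    ... | tri> _ _ e>d = g⊥ w (L-mono e>d Lw)

    -- f - Σ f^{=d} is orthogonal to every level d ≤ n, hence to L (suc n), which contains it.
    sum-of-levels : ∀ {f hs} → IsDecomp m f hs → f ≈ (λ x → sumTo (suc n) (λ d → hs d x))
    sum-of-levels {f} {hs} dec x x∈ = p-q≡0⇒p≡q (f x) (Σhs x) (⟨⟩-definite r r⊥r x x∈)
      where
      open ≡-Reasoning
      Σhs r : Fun n
      Σhs x = sumTo (suc n) (λ d → hs d x)
      r = f -ᶠ Σhs
      r⊥levels : ∀ {d} → d ℕ.< suc n → r ⊥ Level d
      r⊥levels {d} d≤n w Lw = begin
        ⟨ f -ᶠ Σhs , w ⟩              ≡⟨ ⟨⟩-diffˡ f Σhs w ⟩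
        ⟨ f , w ⟩ - ⟨ Σhs , w ⟩       ≡⟨ cong (λ z → ⟨ f , w ⟩ - z) (⟨⟩-sumTo (suc n) hs w) ⟩
        ⟨ f , w ⟩ - sumTo (suc n) (λ e → ⟨ hs e , w ⟩)
          ≡⟨ cong (λ z → ⟨ f , w ⟩ - z) (sumTo-single (suc n) {λ e → ⟨ hs e , w ⟩} d≤n
                                           (λ {e} _ e≢d → levels-orthogonal {f = f} (dec e) e≢d Lw)) ⟩
        ⟨ f , w ⟩ - ⟨ hs d , w ⟩      ≡⟨ ⟨⟩-diffˡ f (hs d) w ⟨
        ⟨ f -ᶠ hs d , w ⟩             ≡⟨ proj₂ (proj₂ (dec d)) w (proj₁ Lw) (proj₂ Lw) ⟩
        0ℚ                            ∎
      r⊥r : ⟨ r , r ⟩ ≡ 0ℚ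
      r⊥r = ⊥-levels⇒⊥-L {r} (suc n) r⊥levels r (L-everything r)

    level-unique : ∀ {d F F′ g g′} → IsLevel m d F g → IsLevel m d F′ g′ → L d (F -ᶠ F′) → g ≈ g′
    level-unique {d} {F} {F′} {g} {g′} (Lg , g⊥ , F-g⊥) (Lg′ , g′⊥ , F′-g′⊥) LF-F′ x x∈ =
      p-q≡0⇒p≡q (g x) (g′ x) (⟨⟩-definite δ δ⊥δ x x∈)
      where
      open ≡-Reasoning
      δ = g -ᶠ g′
      δ⊥L : δ ⊥ L d
      δ⊥L u Lu = trans (⟨⟩-diffˡ g g′ u) (trans (cong₂ _-_ (g⊥ u Lu) (g′⊥ u Lu)) (ℚ.+-inverseʳ 0ℚ))
      Lδ : L (suc d) δ
      Lδ = L-diff Lg Lg′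
      F≡g : ⟨ F , δ ⟩ ≡ ⟨ g , δ ⟩
      F≡g = p-q≡0⇒p≡q _ _ (trans (sym (⟨⟩-diffˡ F g δ)) (F-g⊥ δ Lδ δ⊥L))
      F′≡g′ : ⟨ F′ , δ ⟩ ≡ ⟨ g′ , δ ⟩
      F′≡g′ = p-q≡0⇒p≡q _ _ (trans (sym (⟨⟩-diffˡ F′ g′ δ)) (F′-g′⊥ δ Lδ δ⊥L))
      δ⊥δ : ⟨ δ , δ ⟩ ≡ 0ℚ
      δ⊥δ = begin
        ⟨ g -ᶠ g′ , δ ⟩        ≡⟨ ⟨⟩-diffˡ g g′ δ ⟩
        ⟨ g , δ ⟩ - ⟨ g′ , δ ⟩ ≡⟨ cong₂ _-_ F≡g F′≡g′ ⟨
        ⟨ F , δ ⟩ - ⟨ F′ , δ ⟩ ≡⟨ ⟨⟩-diffˡ F F′ δ ⟨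
        ⟨ F -ᶠ F′ , δ ⟩        ≡⟨ ⟨⟩-comm (F -ᶠ F′) δ ⟩
        ⟨ δ , F -ᶠ F′ ⟩        ≡⟨ δ⊥L (F -ᶠ F′) LF-F′ ⟩
        0ℚ                     ∎

    below : ℕ → (ℕ → Fun n) → Fun n
    below k hs x = sumTo (suc n) (λ d → if k ℕ.≤ᵇ d then 0ℚ else hs d x)

    L-below : ∀ k {f hs} → IsDecomp m f hs → L k (below k hs)
    L-below k {hs = hs} dec = L-sumTo (suc n) _ (λ {d} _ → term d)
      where
      term : ∀ d → L k (λ x → if k ℕ.≤ᵇ d then 0ℚ else hs d x)
      term d with k ℕ.≤ᵇ d in k≤ᵇd
      ... | true  = L-zero
      ... | false = L-mono (ℕ.≰⇒> λ k≤d → subst Bool.T k≤ᵇd (ℕ.≤⇒≤ᵇ k≤d)) (proj₁ (dec d))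

    DP-split : ∀ P k {f hs} → IsDecomp m f hs → DP P f ≈ DP P (geq k hs) +ᶠ DP P (below k hs)
    DP-split P k {f} {hs} dec x x∈ =
      trans (DP-≈ P (≈-trans (sum-of-levels {f} dec) (≗⇒≈ partition)) x x∈) (DP-+ P (geq k hs) (below k hs) x)
      where
      partition : (λ x → sumTo (suc n) (λ d → hs d x)) ≗ geq k hs +ᶠ below k hs
      partition x = sumTo-partition (suc n) (k ℕ.≤ᵇ_) (λ d → hs d x)

    DP-geq : ∀ P → Unique (pairElems P) → ∀ {f hs} → IsDecomp m f hs → DP P f ≈ DP P (geq (length P) hs)
    DP-geq P unique {f} {hs} dec x x∈ = begin
      DP P f x                                 ≡⟨ DP-split P k {f} dec x x∈ ⟩
      DP P (geq k hs) x + DP P (below k hs) x  ≡⟨ cong (DP P (geq k hs) x +_) (DP-kills-L P unique (L-below k {f} dec) x x∈) ⟩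
      DP P (geq k hs) x + 0ℚ                   ≡⟨ ℚ.+-identityʳ _ ⟩
      DP P (geq k hs) x                        ∎
      where
      open ≡-Reasoning
      k = length P

    geq-cong : ∀ k {gs ks} → (∀ {d} → k ℕ.≤ d → gs d ≈ ks d) → geq k gs ≈ geq k ks
    geq-cong k {gs} {ks} gs≈ks x x∈ = sumTo-cong (suc n) (λ {d} _ → term d)
      where
      term : ∀ d → (if k ℕ.≤ᵇ d then gs d x else 0ℚ) ≡ (if k ℕ.≤ᵇ d then ks d x else 0ℚ)
      term d with k ℕ.≤ᵇ d in k≤ᵇd
      ... | true  = gs≈ks (ℕ.≤ᵇ⇒≤ k d (subst Bool.T (sym k≤ᵇd) _)) x x∈
      ... | false = refl

    gt-DP-gt : ∀ P r {f hs gs ks} → IsDecomp m f hs → IsDecomp m (DP P f) gs → IsDecomp m (DP P (gt r hs)) ks →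
      gt r gs ≈ gt r ks
    gt-DP-gt P r {f} {hs} dec decDP decDP-gt = geq-cong (suc r) λ r<d →
      level-unique {F = DP P f} {F′ = DP P (gt r hs)} (decDP _) (decDP-gt _)
        (L-mono r<d (L-≈ difference (L-DP P (L-below (suc r) {f} dec))))
      where
      difference : DP P f -ᶠ DP P (gt r hs) ≈ DP P (below (suc r) hs)
      difference x x∈ = trans (cong (_- DP P (gt r hs) x) (DP-split P (suc r) {f} dec x x∈))
        (solve 2 (λ a b → a :+ b :- a := b) refl (DP P (gt r hs) x) (DP P (below (suc r) hs) x))

open Lemmas
open import Data.Nat using (ℕ; _<_; _≤_; _*_)
open import Data.Fin using (Fin)
open import Data.Fin.Subset using (Subset; ∣_∣)
open import Data.List using (List; length)
open import Data.Product using (_×_; _,_)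
open import Data.Sum as Sum using (_⊎_)
open import Data.Rational using (ℚ)
open import Relation.Binary.PropositionalEquality using (_≡_)
open import Relation.Nullary using (¬_)
open import Function using (_∘_)

claim2p11 : (n m : ℕ) → 0 < m → 2 * m ≤ n →
    (P : List (Fin n × Fin n)) → IsTuple P →
    (T : Subset n) → (f : Fun n) →
    (∣ T ∣ < length P → DP P (AND T) ≈[ m ] zeroF) ×
    (∣ T ∣ ≡ length P →
      (¬ EachPairOne T P → DP P (AND T) ≈[ m ] zeroF) ×
      (EachPairOne T P →
        (DP P (AND T) ≈[ m ] (λ x → half^ (length P) Data.Rational.* Ψ P x)) ⊎
        (DP P (AND T) ≈[ m ] (λ x → Data.Rational.- (half^ (length P) Data.Rational.* Ψ P x))))) ×
    (∀ hs → IsDecomp m f hs → DP P f ≈[ m ] DP P (geq (length P) hs)) ×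
    (∀ (r : ℕ) → 0 < r → ∀ hs → IsDecomp m f hs →
      ∀ gs → IsDecomp m (DP P f) gs →
      ∀ ks → IsDecomp m (DP P (gt r hs)) ks →
      gt r gs ≈[ m ] gt r ks)
claim2p11 n m _ _ P (_ , unique) T f =
    (λ ∣T∣<k → ≗⇒≈ (DP-AND-low-degree P unique T ∣T∣<k))
  , (λ ∣T∣≡k → ≗⇒≈ ∘ DP-AND-¬EachPairOne P unique T
             , Sum.map ≗⇒≈ ≗⇒≈ ∘ DP-AND-top-degree P unique T ∣T∣≡k)
  , (λ _ → DP-geq P unique)
  , (λ r _ _ decomposed _ DP-decomposed _ DP-gt-decomposed → gt-DP-gt P r decomposed DP-decomposed DP-gt-decomposed)
  where
  open OnSlice n m
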